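{- Let $A:\mathcal I\to\mathcal J$ be a functor between finite Cauchy complete categories. Then $A$ is open if and only if for every $x\in\mathcal I$ the induced functor on coslices $A_{x/}:\mathcal I_{x/}\to\mathcal J_{Ax/}$, $(u:x\to y)\mapsto(Au:Ax\to Ay)$, is essentially surjective.
   Context: $A$ is open means: for every $x\in\mathcal I$ and every $f:Ax\to a$ in $\mathcal J$ there exist $u:x\to y$ in $\mathcal I$ and $s:a\to Ay$, $r:Ay\to a$ in $\mathcal J$ with $rs=1_a$ and $sf=Au$ (equivalently, precomposition $A^{*}:[\mathcal J,\mathbf{Set}_{\mathrm f}]\to[\mathcal I,\mathbf{Set}_{\mathrm f}]$ is a Heyting functor). $\mathcal I_{x/}$ denotes the coslice category of arrows out of $x$. -}

module Defs where

open import Data.Nat using (ℕ)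
open import Data.Fin using (Fin)
open import Data.Product using (Σ; ∃; ∃-syntax; _×_; _,_; proj₁; proj₂)
open import Function.Bundles using (_↔_)
open import Relation.Binary.PropositionalEquality using (_≡_)

record Category : Set₁ where
  infixr 9 _∘_
  field
    Obj   : Set
    Hom   : Obj → Obj → Set
    id    : ∀ {a} → Hom a a
    _∘_   : ∀ {a b c} → Hom b c → Hom a b → Hom a c
    identityˡ : ∀ {a b} (f : Hom a b) → id ∘ f ≡ f
    identityʳ : ∀ {a b} (f : Hom a b) → f ∘ id ≡ f
    assoc : ∀ {a b c d} (h : Hom c d) (g : Hom b c) (f : Hom a b) →
            (h ∘ g) ∘ f ≡ h ∘ (g ∘ f)

open Category public

IsFinite : Category → Set
IsFinite C = (Σ ℕ λ n → Obj C ↔ Fin n) × (∀ a b → Σ ℕ λ m → Hom C a b ↔ Fin m)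

IsCauchyComplete : Category → Set
IsCauchyComplete C =
  ∀ {a} (e : Hom C a a) → _∘_ C e e ≡ e →
  ∃[ b ] Σ (Hom C b a) λ s → Σ (Hom C a b) λ r →
    (_∘_ C r s ≡ id C) × (_∘_ C s r ≡ e)

record Functor (C D : Category) : Set where
  field
    F₀ : Obj C → Obj D
    F₁ : ∀ {a b} → Hom C a b → Hom D (F₀ a) (F₀ b)
    F-id : ∀ {a} → F₁ (id C {a}) ≡ id D
    F-∘  : ∀ {a b c} (g : Hom C b c) (f : Hom C a b) →
           F₁ (_∘_ C g f) ≡ _∘_ D (F₁ g) (F₁ f)

open Functor public

IsOpen : ∀ {I J} → Functor I J → Set
IsOpen {I} {J} A =
  ∀ (x : Obj I) {a : Obj J} (f : Hom J (F₀ A x) a) →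
  ∃[ y ] Σ (Hom I x y) λ u →
  Σ (Hom J a (F₀ A y)) λ s → Σ (Hom J (F₀ A y) a) λ r →
    (_∘_ J r s ≡ id J) × (_∘_ J s f ≡ F₁ A u)

CosliceObj : (C : Category) → Obj C → Set
CosliceObj C c = Σ (Obj C) λ a → Hom C c a

CosliceIso : (C : Category) (c : Obj C) → CosliceObj C c → CosliceObj C c → Set
CosliceIso C c (a , f) (b , g) =
  Σ (Hom C a b) λ h → Σ (Hom C b a) λ k →
    (_∘_ C h f ≡ g) × (_∘_ C k g ≡ f) ×
    (_∘_ C k h ≡ id C) × (_∘_ C h k ≡ id C)

coslice₀ : ∀ {I J} (A : Functor I J) (x : Obj I) →
           CosliceObj I x → CosliceObj J (F₀ A x)
coslice₀ A x (y , u) = F₀ A y , F₁ A u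

CosliceEssSurj : ∀ {I J} (A : Functor I J) (x : Obj I) → Set
CosliceEssSurj {I} {J} A x =
  ∀ (p : CosliceObj J (F₀ A x)) →
  Σ (CosliceObj I x) λ q → CosliceIso J (F₀ A x) (coslice₀ A x q) p

{-# OPTIONS --safe #-}
module Submission where

-- Openness says that every f : Ax → a is a retract, in J_{Ax/}, of some Au
-- (sections s : a → Ay, retractions r : Ay → a).  Applying openness once more
-- to the idempotent s r on Ay refines such a retraction datum, and the
-- refinement comes with an arrow of I between the two objects lying over the
-- composite of the new section with the old retraction.  There are finitely
-- many retraction data, so iterating the refinement runs into a cycle, and
-- composing around the cycle gives an endomorphism w of y with A w = s r.
-- Some power of w is idempotent and still lies over s r; splitting it in I
-- gives b with A b ≅ a under Ax, because any two splittings of one idempotent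
-- are isomorphic.

open import Defs
open import Data.Fin using (Fin; toℕ)
open import Data.Fin.Properties using (pigeonhole)
open import Data.List using (List; map; concat; length)
open import Data.List.Membership.Propositional.Properties using (∈-map⁺; ∈-concat⁺′; ∈-allFin)
open import Data.List.Membership.Setoid.Properties using (index-injective)
open import Data.List.Relation.Unary.Any using (index)
open import Data.List.Relation.Unary.Enumerates.Setoid using (IsEnumeration)
open import Data.List.Relation.Unary.Enumerates.Setoid.Properties using (map⁺)
open import Data.Nat using (ℕ; zero; suc; _+_; _*_)
open import Data.Nat.GeneralisedArithmetic using (fold; fold-+)
open import Data.Nat.Properties using (n<1+n; m≤n⇒∃[o]m+o≡n; +-comm; +-assoc; *-suc)
open import Data.Product using (Σ; ∃; ∃₂; ∃-syntax; _×_; _,_; proj₁; proj₂)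
open import Function.Bundles using (_⇔_; mk⇔; _↔_)
open import Function.Construct.Symmetry using (↔-sym)
open import Function.Properties.Inverse using (↔⇒↠)
open import Relation.Binary.PropositionalEquality
  using (_≡_; refl; sym; trans; cong; cong₂; subst; setoid; module ≡-Reasoning)

open ≡-Reasoning

Enumerable : Set → Set
Enumerable X = ∃ (IsEnumeration (setoid X))

↔Fin⇒enumerable : ∀ {X : Set} → (Σ ℕ λ n → X ↔ Fin n) → Enumerable X
↔Fin⇒enumerable {X} (n , X↔Fin) =
  _ , map⁺ (setoid (Fin n)) (setoid X) (↔⇒↠ (↔-sym X↔Fin)) ∈-allFin

Σ-enumerable : ∀ {A : Set} {B : A → Set} →
               Enumerable A → (∀ a → Enumerable (B a)) → Enumerable (Σ A B)
Σ-enumerable {A} {B} (as , _∈as) enumB =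
  concat (map fibre as) ,
  λ (a , b) → ∈-concat⁺′ (∈-map⁺ (a ,_) (proj₂ (enumB a) b)) (∈-map⁺ fibre (a ∈as))
  where
  fibre : A → List (Σ A B)
  fibre a = map (a ,_) (proj₁ (enumB a))

×-enumerable : ∀ {A B : Set} → Enumerable A → Enumerable B → Enumerable (A × B)
×-enumerable enumA enumB = Σ-enumerable enumA (λ _ → enumB)

hom-enumerable : (C : Category) → IsFinite C → ∀ a b → Enumerable (Hom C a b)
hom-enumerable C (_ , finHom) a b = ↔Fin⇒enumerable (finHom a b)

module _ {X : Set} (g : X → X) where

  fold-periodic : ∀ {z} d → fold z g d ≡ z → ∀ k → fold z g (k * d) ≡ z
  fold-periodic     d per zero    = refl
  fold-periodic {z} d per (suc k) = begin
    fold z g (d + k * d)         ≡⟨ fold-+ z g d ⟩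
    fold (fold z g (k * d)) g d  ≡⟨ cong (λ z′ → fold z′ g d) (fold-periodic d per k) ⟩
    fold z g d                   ≡⟨ per ⟩
    z                            ∎

  fold-periodic-orbit : ∀ {z} d → fold z g d ≡ z →
                        ∀ t → fold (fold z g t) g d ≡ fold z g t
  fold-periodic-orbit {z} d per t = begin
    fold (fold z g t) g d  ≡⟨ fold-+ z g d ⟨
    fold z g (d + t)       ≡⟨ cong (fold z g) (+-comm d t) ⟩
    fold z g (t + d)       ≡⟨ fold-+ z g t ⟩
    fold (fold z g d) g t  ≡⟨ cong (λ z′ → fold z′ g t) per ⟩
    fold z g t             ∎

  fold-eventually-periodic : Enumerable X → ∀ x →
                             ∃₂ λ i d → fold (fold x g i) g (suc d) ≡ fold x g i
  fold-eventually-periodic (xs , _∈xs) x =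
    let (i , j , i<j , same-index) =
          pigeonhole (n<1+n (length xs)) (λ k → index (fold x g (toℕ k) ∈xs))
        (d , 1+i+d≡j) = m≤n⇒∃[o]m+o≡n i<j
    in toℕ i , d , (begin
      fold (fold x g (toℕ i)) g (suc d)  ≡⟨ fold-+ x g (suc d) ⟨
      fold x g (suc d + toℕ i)           ≡⟨ cong (λ n → fold x g (suc n)) (+-comm d (toℕ i)) ⟩
      fold x g (suc (toℕ i) + d)         ≡⟨ cong (fold x g) 1+i+d≡j ⟩
      fold x g (toℕ j)                   ≡⟨ index-injective (setoid X) _ _ same-index ⟨
      fold x g (toℕ i)                   ∎)

  -- The exponent (i + 1) (d + 1) is a multiple of the period d + 1 and exceeds
  -- the preperiod i.
  fold-idempotent : Enumerable X → ∀ x →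
                    ∃ λ m → fold (fold x g (suc m)) g (suc m) ≡ fold x g (suc m)
  fold-idempotent enum x with fold-eventually-periodic enum x
  ... | i , d , per = d + i * suc d , fold-periodic (suc d) y-periodic (suc i)
    where
    exponent-past-preperiod : suc i * suc d ≡ (suc d + i * d) + i
    exponent-past-preperiod = begin
      suc d + i * suc d    ≡⟨ cong (suc d +_) (*-suc i d) ⟩
      suc d + (i + i * d)  ≡⟨ cong (suc d +_) (+-comm i (i * d)) ⟩
      suc d + (i * d + i)  ≡⟨ +-assoc (suc d) (i * d) i ⟨
      (suc d + i * d) + i  ∎

    y-on-cycle : fold x g (suc i * suc d) ≡ fold (fold x g i) g (suc d + i * d)
    y-on-cycle = trans (cong (fold x g) exponent-past-preperiod) (fold-+ x g (suc d + i * d))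

    y-periodic : fold (fold x g (suc i * suc d)) g (suc d) ≡ fold x g (suc i * suc d)
    y-periodic = subst (λ y → fold y g (suc d) ≡ y) (sym y-on-cycle)
                       (fold-periodic-orbit (suc d) per (suc d + i * d))

module CategoryProperties (C : Category) where
  open Category C using () renaming (_∘_ to _∙_)

  cancel-middle : ∀ {p q r s} (a : Hom C q s) {b : Hom C r q} {c : Hom C q r} (d : Hom C p q) →
                  b ∙ c ≡ id C → (a ∙ b) ∙ (c ∙ d) ≡ a ∙ d
  cancel-middle a {b} {c} d bc = begin
    (a ∙ b) ∙ (c ∙ d)  ≡⟨ assoc C a b (c ∙ d) ⟩
    a ∙ (b ∙ (c ∙ d))  ≡⟨ cong (a ∙_) (assoc C b c d) ⟨
    a ∙ ((b ∙ c) ∙ d)  ≡⟨ cong (λ e → a ∙ (e ∙ d)) bc ⟩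
    a ∙ (id C ∙ d)     ≡⟨ cong (a ∙_) (identityˡ C d) ⟩
    a ∙ d              ∎

  retract-idempotent : ∀ {a b} {s : Hom C a b} {r : Hom C b a} →
                       r ∙ s ≡ id C → (s ∙ r) ∙ (s ∙ r) ≡ s ∙ r
  retract-idempotent {s = s} {r} = cancel-middle s r

  splittings-comparison : ∀ {a b c} {p : Hom C a b} {q : Hom C b a} {p′ : Hom C c b} {q′ : Hom C b c} →
                          q ∙ p ≡ id C → p′ ∙ q′ ≡ p ∙ q → (q ∙ p′) ∙ (q′ ∙ p) ≡ id C
  splittings-comparison {p = p} {q} {p′} {q′} qp p′q′ = begin
    (q ∙ p′) ∙ (q′ ∙ p)  ≡⟨ assoc C q p′ (q′ ∙ p) ⟩
    q ∙ (p′ ∙ (q′ ∙ p))  ≡⟨ cong (q ∙_) (assoc C p′ q′ p) ⟨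
    q ∙ ((p′ ∙ q′) ∙ p)  ≡⟨ cong (λ e → q ∙ (e ∙ p)) p′q′ ⟩
    q ∙ ((p ∙ q) ∙ p)    ≡⟨ cong (q ∙_) (assoc C p q p) ⟩
    q ∙ (p ∙ (q ∙ p))    ≡⟨ cong (λ e → q ∙ (p ∙ e)) qp ⟩
    q ∙ (p ∙ id C)       ≡⟨ cong (q ∙_) (identityʳ C p) ⟩
    q ∙ p                ≡⟨ qp ⟩
    id C                 ∎

  infixr 8 _^_
  _^_ : ∀ {y} → Hom C y y → ℕ → Hom C y y
  w ^ n = fold (id C) (w ∙_) n

  fold-∙ : ∀ {y z} (w : Hom C y y) (e : Hom C z y) n → fold e (w ∙_) n ≡ (w ^ n) ∙ e
  fold-∙ w e zero    = sym (identityˡ C e)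
  fold-∙ w e (suc n) = trans (cong (w ∙_) (fold-∙ w e n)) (sym (assoc C w (w ^ n) e))

  power-idempotent : ∀ {y} → Enumerable (Hom C y y) → (w : Hom C y y) →
                     ∃ λ m → (w ^ suc m) ∙ (w ^ suc m) ≡ w ^ suc m
  power-idempotent enum w =
    let (m , idem) = fold-idempotent (w ∙_) enum (id C)
    in m , trans (sym (fold-∙ w (w ^ suc m) (suc m))) idem

module _ {I J : Category} (A : Functor I J) where
  open Category I using () renaming (_∘_ to _·_)
  open Category J using () renaming (_∘_ to _∙_)
  open Functor A using () renaming (F₀ to A₀; F₁ to A₁; F-id to A-id; F-∘ to A-∘)
  open CategoryProperties I using (_^_; power-idempotent)
  open CategoryProperties J using (cancel-middle; retract-idempotent; splittings-comparison)

  power-image : ∀ {y} {w : Hom I y y} {e : Hom J (A₀ y) (A₀ y)} →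
                A₁ w ≡ e → e ∙ e ≡ e → ∀ k → A₁ (w ^ suc k) ≡ e
  power-image {w = w} Aw ee zero    = trans (cong A₁ (identityʳ I w)) Aw
  power-image {w = w} {e} Aw ee (suc k) = begin
    A₁ (w · (w ^ suc k))    ≡⟨ A-∘ w (w ^ suc k) ⟩
    A₁ w ∙ A₁ (w ^ suc k)   ≡⟨ cong₂ _∙_ Aw (power-image Aw ee k) ⟩
    e ∙ e                   ≡⟨ ee ⟩
    e                       ∎

  lift-idempotent-splitting :
    IsCauchyComplete I → ∀ {y} → Enumerable (Hom I y y) →
    (w : Hom I y y) {e : Hom J (A₀ y) (A₀ y)} → A₁ w ≡ e → e ∙ e ≡ e →
    ∃[ b ] Σ (Hom I b y) λ σ → Σ (Hom I y b) λ ρ → (ρ · σ ≡ id I) × (A₁ σ ∙ A₁ ρ ≡ e)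
  lift-idempotent-splitting cc enum w {e} Aw ee =
    let (m , idem) = power-idempotent enum w
        (b , σ , ρ , ρσ , σρ) = cc (w ^ suc m) idem
    in b , σ , ρ , ρσ , (begin
      A₁ σ ∙ A₁ ρ     ≡⟨ A-∘ σ ρ ⟨
      A₁ (σ · ρ)      ≡⟨ cong A₁ σρ ⟩
      A₁ (w ^ suc m)  ≡⟨ power-image Aw ee m ⟩
      e               ∎)

  split-retract⇒coslice-iso :
    ∀ {x y b a} {f : Hom J (A₀ x) a} {u : Hom I x y} {s : Hom J a (A₀ y)} {r : Hom J (A₀ y) a}
      {σ : Hom I b y} {ρ : Hom I y b} →
    r ∙ s ≡ id J → s ∙ f ≡ A₁ u → ρ · σ ≡ id I → A₁ σ ∙ A₁ ρ ≡ s ∙ r →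
    CosliceIso J (A₀ x) (coslice₀ A x (b , ρ · u)) (a , f)
  split-retract⇒coslice-iso {b = b} {a} {f} {u} {s} {r} {σ} {ρ} rs sf ρσ σρ =
    h , k , h∘Aρu≡f , k∘f≡Aρu , k∘h≡id , h∘k≡id
    where
    h : Hom J (A₀ b) a
    h = r ∙ A₁ σ
    k : Hom J a (A₀ b)
    k = A₁ ρ ∙ s

    h∘k≡id : h ∙ k ≡ id J
    h∘k≡id = splittings-comparison rs σρ

    k∘h≡id : k ∙ h ≡ id J
    k∘h≡id = splittings-comparison (trans (sym (A-∘ ρ σ)) (trans (cong A₁ ρσ) A-id)) (sym σρ)

    k∘f≡Aρu : k ∙ f ≡ A₁ (ρ · u)
    k∘f≡Aρu = begin
      (A₁ ρ ∙ s) ∙ f  ≡⟨ assoc J (A₁ ρ) s f ⟩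
      A₁ ρ ∙ (s ∙ f)  ≡⟨ cong (A₁ ρ ∙_) sf ⟩
      A₁ ρ ∙ A₁ u     ≡⟨ A-∘ ρ u ⟨
      A₁ (ρ · u)      ∎

    h∘Aρu≡f : h ∙ A₁ (ρ · u) ≡ f
    h∘Aρu≡f = begin
      h ∙ A₁ (ρ · u)  ≡⟨ cong (h ∙_) k∘f≡Aρu ⟨
      h ∙ (k ∙ f)     ≡⟨ assoc J h k f ⟨
      (h ∙ k) ∙ f     ≡⟨ cong (_∙ f) h∘k≡id ⟩
      id J ∙ f        ≡⟨ identityˡ J f ⟩
      f               ∎

  coslice-essSurj⇒open : (∀ x → CosliceEssSurj A x) → IsOpen A
  coslice-essSurj⇒open essSurj x f =
    let ((y , u) , h , k , _ , kf , _ , hk) = essSurj x (_ , f) in y , u , k , h , hk , kf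

  module FromOpen (isOpen : IsOpen A) (x : Obj I) {a : Obj J} (f : Hom J (A₀ x) a) where

    Datum : Set
    Datum = Σ (Obj I) λ y → Hom I x y × Hom J a (A₀ y) × Hom J (A₀ y) a

    IsRetract : Datum → Set
    IsRetract (y , u , s , r) = (r ∙ s ≡ id J) × (s ∙ f ≡ A₁ u)

    _↝_ : Datum → Datum → Set
    (y , _ , _ , r) ↝ (y′ , _ , s′ , _) = Σ (Hom I y y′) λ w → A₁ w ≡ s′ ∙ r

    ↝-trans : ∀ {p q q′} → IsRetract q → p ↝ q → q ↝ q′ → p ↝ q′
    ↝-trans {_ , _ , _ , r} {_ , _ , s , r′} {_ , _ , s″ , _} (r′s , _) (w , Aw) (w′ , Aw′) =
      w′ · w , (begin
        A₁ (w′ · w)              ≡⟨ A-∘ w′ w ⟩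
        A₁ w′ ∙ A₁ w             ≡⟨ cong₂ _∙_ Aw′ Aw ⟩
        (s″ ∙ r′) ∙ (s ∙ r)      ≡⟨ cancel-middle s″ r r′s ⟩
        s″ ∙ r                   ∎)

    refine : Datum → Datum
    refine (y , u , s , r) =
      let (z , v , s₁ , r₁ , _) = isOpen y (s ∙ r) in z , v · u , s₁ ∙ s , r ∙ r₁

    ↝-refine : ∀ p → p ↝ refine p
    ↝-refine (y , u , s , r) =
      let (z , v , s₁ , r₁ , _ , s₁sr≡Av) = isOpen y (s ∙ r)
      in v , sym (trans (assoc J s₁ s r) s₁sr≡Av)

    refine-isRetract : ∀ p → IsRetract p → IsRetract (refine p)
    refine-isRetract (y , u , s , r) (rs , sf) =
      let (z , v , s₁ , r₁ , r₁s₁ , s₁sr≡Av) = isOpen y (s ∙ r)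
      in trans (cancel-middle r s r₁s₁) rs , (begin
        (s₁ ∙ s) ∙ f              ≡⟨ cancel-middle (s₁ ∙ s) f rs ⟨
        ((s₁ ∙ s) ∙ r) ∙ (s ∙ f)  ≡⟨ cong₂ _∙_ (assoc J s₁ s r) sf ⟩
        (s₁ ∙ (s ∙ r)) ∙ A₁ u     ≡⟨ cong (_∙ A₁ u) s₁sr≡Av ⟩
        A₁ v ∙ A₁ u               ≡⟨ A-∘ v u ⟨
        A₁ (v · u)                ∎)

    fold-refine-isRetract : ∀ {p} → IsRetract p → ∀ n → IsRetract (fold p refine n)
    fold-refine-isRetract ret zero    = ret
    fold-refine-isRetract ret (suc n) = refine-isRetract _ (fold-refine-isRetract ret n)

    ↝-fold-refine : ∀ {p} → IsRetract p → ∀ n → p ↝ fold p refine (suc n)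
    ↝-fold-refine {p} _ zero = ↝-refine p
    ↝-fold-refine {p} ret (suc n) =
      ↝-trans {p} {q} {refine q} (fold-refine-isRetract ret (suc n)) (↝-fold-refine ret n) (↝-refine q)
      where
      q : Datum
      q = fold p refine (suc n)

    datum-enumerable : IsFinite I → IsFinite J → Enumerable Datum
    datum-enumerable finI@(finObjI , _) finJ =
      Σ-enumerable (↔Fin⇒enumerable finObjI) λ y →
        ×-enumerable (hom-enumerable I finI x y)
          (×-enumerable (hom-enumerable J finJ a (A₀ y)) (hom-enumerable J finJ (A₀ y) a))

    self-linked-retract : Enumerable Datum → ∃ λ q → IsRetract q × q ↝ q
    self-linked-retract enum =
      let (y , u , s , r , ret) = isOpen x f
          p = y , u , s , r
          (i , d , cycle) = fold-eventually-periodic refine enum p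
          q = fold p refine i
          retQ = fold-refine-isRetract ret i
      in q , retQ , subst (q ↝_) cycle (↝-fold-refine retQ d)

    coslice-preimage : IsFinite I → IsFinite J → IsCauchyComplete I →
                       Σ (CosliceObj I x) λ c → CosliceIso J (A₀ x) (coslice₀ A x c) (a , f)
    coslice-preimage finI finJ cc =
      let ((y , u , s , r) , (rs , sf) , (w , Aw)) = self-linked-retract (datum-enumerable finI finJ)
          (b , σ , ρ , ρσ , σρ) =
            lift-idempotent-splitting cc (hom-enumerable I finI y y) w Aw (retract-idempotent rs)
      in (b , ρ · u) , split-retract⇒coslice-iso rs sf ρσ σρ

  open⇒coslice-essSurj : IsFinite I → IsFinite J → IsCauchyComplete I →
                         IsOpen A → ∀ x → CosliceEssSurj A x
  open⇒coslice-essSurj finI finJ cc isOpen x (a , f) =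
    FromOpen.coslice-preimage isOpen x f finI finJ cc

proposition2p25 : (I J : Category) → IsFinite I → IsFinite J →
    IsCauchyComplete I → IsCauchyComplete J → (A : Functor I J) →
    IsOpen A ⇔ ((x : Obj I) → CosliceEssSurj A x)
proposition2p25 I J finI finJ ccI _ A =
  mk⇔ (open⇒coslice-essSurj A finI finJ ccI) (coslice-essSurj⇒open A)
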